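{- Any streaming certification scheme for $\mathrm{Diameter}_{\geq 8}$ whose verifier uses $m$ bits of memory and whose certificates have $c$ bits satisfies $c+m=\Omega(n)$ on $n$-node graphs.
   Context: $\mathrm{Diameter}_{\geq 8}$ is the decision problem (with fixed threshold $8$) taking as input a graph $G$ and asking whether the diameter of $G$ (the maximum over pairs of vertices of their shortest-path distance) is at least $8$. The $n$-node input graph on $[n]$ is given as a stream of edges in an arbitrary, possibly adversarial, order. A streaming certification scheme for a decision problem $P$ consists of a prover (a computationally unlimited function producing a certificate in $\{0,1\}^*$ depending only on the input graph, not on the edge order) and a verifier (a deterministic streaming algorithm with read-only access to the certificate that processes the stream and outputs accept or reject). Completeness: if $G$ satisfies $P$, some certificate makes the verifier accept for every edge order. Soundness: if $G$ does not satisfy $P$, the verifier rejects for every certificate and every edge order. $c$ is the certificate length and $m$ the verifier's memory excluding the certificate, as worst-case functions of $n$. -}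

module Defs where

open import Data.Nat using (ℕ; zero; suc; _<_; _≤_)
open import Data.Bool using (Bool; true; false)
open import Data.Fin using (Fin; toℕ)
open import Data.Vec using (Vec)
open import Data.List using (List; []; _∷_; foldl; length)
open import Data.List.Membership.Propositional using (_∈_)
open import Data.List.Relation.Unary.Unique.Propositional using (Unique)
open import Data.Product using (Σ; ∃; _×_; _,_)
open import Relation.Binary.PropositionalEquality using (_≡_)
open import Relation.Nullary using (¬_)
open import Function.Bundles using (_⇔_)

record Graph (n : ℕ) : Set where
  field
    adj     : Fin n → Fin n → Bool
    sym     : ∀ u v → adj u v ≡ adj v u
    irrefl  : ∀ u → adj u u ≡ false

open Graph public

Edge : ℕ → Set
Edge n = Fin n × Fin n

data Walk {n : ℕ} (G : Graph n) : ℕ → Fin n → Fin n → Set where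
  here : ∀ {u} → Walk G zero u u
  step : ∀ {k u w v} → adj G u w ≡ true → Walk G k w v → Walk G (suc k) u v

-- dist(u,v) ≥ 8 (including dist = ∞): there is no walk of length < 8.
DistAtLeast8 : ∀ {n} → Graph n → Fin n → Fin n → Set
DistAtLeast8 G u v = ∀ k → k < 8 → ¬ Walk G k u v

Diameter≥8 : ∀ {n} → Graph n → Set
Diameter≥8 {n} G = Σ (Fin n) λ u → Σ (Fin n) λ v → DistAtLeast8 G u v

IsStream : ∀ {n} → Graph n → List (Edge n) → Set
IsStream {n} G L =
  Unique L × (∀ (u v : Fin n) → ((u , v) ∈ L) ⇔ ((toℕ u < toℕ v) × (adj G u v ≡ true)))

Certificate : Set
Certificate = List Bool

-- A deterministic streaming verifier on n-node graphs with m bits of memory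
-- (excluding the certificate), with read-only (unrestricted) access to the certificate.
record Verifier (n m : ℕ) : Set where
  field
    init   : Certificate → Vec Bool m
    update : Certificate → Vec Bool m → Edge n → Vec Bool m
    decide : Certificate → Vec Bool m → Bool

open Verifier public

run : ∀ {n m} → Verifier n m → Certificate → List (Edge n) → Bool
run V cert L = decide V cert (foldl (update V cert) (init V cert) L)

record Scheme (n c m : ℕ) : Set where
  field
    verifier     : Verifier n m
    completeness : ∀ (G : Graph n) → Diameter≥8 G →
                   Σ Certificate λ cert → (length cert ≤ c) ×
                     (∀ L → IsStream G L → run verifier cert L ≡ true)
    soundness    : ∀ (G : Graph n) → ¬ Diameter≥8 G →
                   ∀ (cert : Certificate) L → IsStream G L → run verifier cert L ≡ false

-- Reduction from two-party equality on k = n − 4 bits. Besides the leaves 0 … k−1 the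
-- graph has four hubs hub₀ s, hub₁ s (s : Bool), joined by the edges hub₀ s — hub₁ s.
-- Alice, holding x, joins leaf j to hub₀ (x j); Bob, holding y, joins leaf j to hub₁ (y j).
-- For y = x every vertex only meets vertices of its own side (s or x j), so the graph is
-- disconnected and has infinite diameter. If x i ≠ y i, leaf i meets both sides and every
-- vertex is within distance 3 of it, so the diameter is at most 6. A certificate for (x , x)
-- together with the memory after Alice's edges therefore determines x: otherwise the verifier
-- would also accept some (x , y) with y ≠ x. Hence 2^k ≤ 2^(2c + m).

module Submission where

open import Defs hiding (sym)
open import Data.Bool using (Bool; true; false; _∨_)
open import Data.Bool.Properties using (∨-comm; ¬-not; T-≡)
import Data.Bool.Properties as Bool
open import Data.Fin using (Fin; zero; suc; toℕ)
open import Data.Fin.Properties using (injective⇒≤; *↔×; 2↔Bool)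
open import Data.List using (List; []; _∷_; _++_; foldl; length; filter; cartesianProduct; allFin)
open import Data.List.Membership.Propositional using (_∈_)
open import Data.List.Membership.Propositional.Properties
  using (∈-filter⁺; ∈-filter⁻; ∈-++⁻; ∈-++⁺ˡ; ∈-++⁺ʳ; ∈-cartesianProduct⁺; ∈-allFin)
open import Data.List.Properties using (foldl-++)
open import Data.List.Relation.Unary.Unique.Propositional.Properties
  using (++⁺; filter⁺; cartesianProduct⁺; allFin⁺)
open import Data.Nat using (ℕ; zero; suc; _+_; _*_; _^_; _≤_; _<_; _<?_; z≤n; s≤s)
open import Data.Nat.Properties
  using (≤-refl; ≤-trans; <⇒≱; ≮⇒≥; ^-monoʳ-<; m≤m+n; +-mono-≤; m≤m*n; *-distribʳ-+)
open import Data.Nat.Tactic.RingSolver using (solve-∀)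
open import Data.Product using (Σ; ∃; _×_; _,_; proj₁; proj₂; uncurry)
open import Data.Product.Function.NonDependent.Propositional using (_×-↔_)
open import Data.Sum using (_⊎_; inj₁; inj₂)
open import Data.Vec using (Vec; []; _∷_; lookup)
  renaming (_++_ to _++ᵛ_)
open import Data.Vec.Properties using (∷-injective; ++-injectiveˡ; ++-injectiveʳ; ≡-dec)
open import Function using (_∘_)
open import Function.Bundles using (_↔_; _↣_; Injection; Equivalence; mk↔ₛ′; mk↣; mk⇔)
open import Function.Properties.Inverse using (↔-trans; ↔-sym; ↔⇒↣)
open import Function.Properties.Injection using (↣-trans)
open import Relation.Binary.PropositionalEquality
  using (_≡_; _≢_; refl; sym; trans; cong; cong₂; subst; subst₂; module ≡-Reasoning)
open import Relation.Nullary using (¬_; yes; no; contradiction)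
open import Relation.Unary using (Decidable)
open import Relation.Nullary.Decidable using (⌊_⌋; toWitness; fromWitness; decidable-stable; _×-dec_)

Fin2^↔Vec : ∀ k → Fin (2 ^ k) ↔ Vec Bool k
Fin2^↔Vec zero    = mk↔ₛ′ (λ _ → []) (λ _ → zero) (λ { [] → refl }) (λ { zero → refl })
Fin2^↔Vec (suc k) = ↔-trans *↔× (↔-trans (2↔Bool ×-↔ Fin2^↔Vec k) ×↔∷)
  where
  ×↔∷ : (Bool × Vec Bool k) ↔ Vec Bool (suc k)
  ×↔∷ = mk↔ₛ′ (uncurry _∷_) (λ { (b ∷ v) → b , v }) (λ { (_ ∷ _) → refl }) (λ _ → refl)

Vec-↣⇒≤ : ∀ {k j} → Vec Bool k ↣ Vec Bool j → k ≤ j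
Vec-↣⇒≤ {k} {j} F = ≮⇒≥ (λ j<k → <⇒≱ (^-monoʳ-< 2 (s≤s (s≤s z≤n)) j<k) 2^k≤2^j)
  where
  2^k≤2^j : 2 ^ k ≤ 2 ^ j
  2^k≤2^j = injective⇒≤ (Injection.injective
    (↣-trans (↔⇒↣ (Fin2^↔Vec k)) (↣-trans F (↔⇒↣ (↔-sym (Fin2^↔Vec j))))))

pad : (c : ℕ) → List Bool → Vec Bool (c * 2)
pad zero    _       = []
pad (suc c) []      = false ∷ false ∷ pad c []
pad (suc c) (b ∷ l) = true ∷ b ∷ pad c l

pad-injective : ∀ c {l l′ : List Bool} → length l ≤ c → length l′ ≤ c →
                pad c l ≡ pad c l′ → l ≡ l′
pad-injective zero    {[]}    {[]}     _       _       _  = refl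
pad-injective (suc c) {[]}    {[]}     _       _       _  = refl
pad-injective (suc c) {b ∷ l} {b′ ∷ l′} (s≤s p) (s≤s q) eq
  with refl , eq′ ← ∷-injective eq
  with refl , eq″ ← ∷-injective eq′
  = cong (b ∷_) (pad-injective c p q eq″)

lookup-≢ : ∀ {k} {x y : Vec Bool k} → x ≢ y → ∃ λ i → lookup x i ≢ lookup y i
lookup-≢ {x = []}    {[]}    x≢y = contradiction refl x≢y
lookup-≢ {x = a ∷ x} {b ∷ y} x≢y with a Bool.≟ b
... | no a≢b   = zero , a≢b
... | yes refl with i , d ← lookup-≢ (x≢y ∘ cong (a ∷_)) = suc i , d

≢-cover : ∀ {a b : Bool} → a ≢ b → ∀ s → s ≡ a ⊎ s ≡ b
≢-cover {a} a≢b s with s Bool.≟ a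
... | yes s≡a = inj₁ s≡a
... | no  s≢a = inj₂ (trans (¬-not s≢a) (sym (¬-not (a≢b ∘ sym))))

⌊≟⌋-sound : ∀ {s t : Bool} → ⌊ s Bool.≟ t ⌋ ≡ true → s ≡ t
⌊≟⌋-sound e = toWitness (Equivalence.from T-≡ e)

⌊≟⌋-complete : ∀ {s t : Bool} → s ≡ t → ⌊ s Bool.≟ t ⌋ ≡ true
⌊≟⌋-complete e = Equivalence.to T-≡ (fromWitness e)

∨-≡-true : ∀ {a b} → a ∨ b ≡ true → a ≡ true ⊎ b ≡ true
∨-≡-true {true}  _ = inj₁ refl
∨-≡-true {false} e = inj₂ e

∨-≡-trueˡ : ∀ {a} b → a ≡ true → a ∨ b ≡ true
∨-≡-trueˡ b refl = refl

∨-≡-trueʳ : ∀ a {b} → b ≡ true → a ∨ b ≡ true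
∨-≡-trueʳ true  _ = refl
∨-≡-trueʳ false e = e

symmetrise : ∀ {R : Set} → (R → R → Bool) → R → R → Bool
symmetrise arc r r′ = arc r r′ ∨ arc r′ r

arcGraph : ∀ {n} {R : Set} (label : Fin n → R) (arc : R → R → Bool) →
           (∀ r → arc r r ≡ false) → Graph n
arcGraph label arc arc-irrefl = record
  { adj    = λ u v → symmetrise arc (label u) (label v)
  ; sym    = λ u v → ∨-comm (arc (label u) (label v)) _
  ; irrefl = λ u → cong₂ _∨_ (arc-irrefl (label u)) (arc-irrefl (label u))
  }

_∪_ : ∀ {n} → Graph n → Graph n → Graph n
G ∪ H = record
  { adj    = λ u v → adj G u v ∨ adj H u v
  ; sym    = λ u v → cong₂ _∨_ (Graph.sym G u v) (Graph.sym H u v)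
  ; irrefl = λ u → cong₂ _∨_ (irrefl G u) (irrefl H u)
  }

EdgeDisjoint : ∀ {n} → Graph n → Graph n → Set
EdgeDisjoint {n} G H = ∀ (u v : Fin n) → adj G u v ≡ true → adj H u v ≡ false

allPairs : ∀ n → List (Edge n)
allPairs n = cartesianProduct (allFin n) (allFin n)

IsOrientedEdge : ∀ {n} → Graph n → Edge n → Set
IsOrientedEdge G (u , v) = toℕ u < toℕ v × adj G u v ≡ true

isOrientedEdge? : ∀ {n} (G : Graph n) → Decidable (IsOrientedEdge G)
isOrientedEdge? G (u , v) = toℕ u <? toℕ v ×-dec adj G u v Bool.≟ true

edges : ∀ {n} → Graph n → List (Edge n)
edges {n} G = filter (isOrientedEdge? G) (allPairs n)

edges-stream : ∀ {n} (G : Graph n) → IsStream G (edges G)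
edges-stream {n} G =
  filter⁺ (isOrientedEdge? G) (cartesianProduct⁺ (allFin⁺ n) (allFin⁺ n)) ,
  λ u v → mk⇔ (proj₂ ∘ ∈-filter⁻ (isOrientedEdge? G) {xs = allPairs n})
              (∈-filter⁺ (isOrientedEdge? G) (∈-cartesianProduct⁺ (∈-allFin u) (∈-allFin v)))

∪-stream : ∀ {n} {G H : Graph n} {L L′ : List (Edge n)} → EdgeDisjoint G H →
           IsStream G L → IsStream H L′ → IsStream (G ∪ H) (L ++ L′)
∪-stream {G = G} {H} {L} {L′} disjoint (uniq , ∈L⇔) (uniq′ , ∈L′⇔) =
  ++⁺ uniq uniq′ not-in-both , λ u v → mk⇔ (to u v) (from u v)
  where
  not-in-both : ∀ {e} → ¬ (e ∈ L × e ∈ L′)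
  not-in-both {u , v} (e∈L , e∈L′) with () ←
    trans (sym (disjoint u v (proj₂ (Equivalence.to (∈L⇔ u v) e∈L))))
          (proj₂ (Equivalence.to (∈L′⇔ u v) e∈L′))

  to : ∀ u v → (u , v) ∈ L ++ L′ → toℕ u < toℕ v × adj (G ∪ H) u v ≡ true
  to u v e∈ with ∈-++⁻ L e∈
  ... | inj₁ e∈L  = let u<v , uv∈G = Equivalence.to (∈L⇔ u v) e∈L
                    in u<v , ∨-≡-trueˡ (adj H u v) uv∈G
  ... | inj₂ e∈L′ = let u<v , uv∈H = Equivalence.to (∈L′⇔ u v) e∈L′
                    in u<v , ∨-≡-trueʳ (adj G u v) uv∈H

  from : ∀ u v → toℕ u < toℕ v × adj (G ∪ H) u v ≡ true → (u , v) ∈ L ++ L′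
  from u v (u<v , uv∈G∪H) with ∨-≡-true uv∈G∪H
  ... | inj₁ uv∈G = ∈-++⁺ˡ (Equivalence.from (∈L⇔ u v) (u<v , uv∈G))
  ... | inj₂ uv∈H = ∈-++⁺ʳ L (Equivalence.from (∈L′⇔ u v) (u<v , uv∈H))

module _ {n} (G : Graph n) where

  walk-++ : ∀ {l l′ u v w} → Walk G l u v → Walk G l′ v w → Walk G (l + l′) u w
  walk-++ here       q = q
  walk-++ (step e p) q = step e (walk-++ p q)

  walk-snoc : ∀ {l u v w} → Walk G l u v → adj G v w ≡ true → Walk G (suc l) u w
  walk-snoc here       e = step e here
  walk-snoc (step e p) e′ = step e (walk-snoc p e′)

  walk-reverse : ∀ {l u v} → Walk G l u v → Walk G l v u
  walk-reverse here                       = here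
  walk-reverse (step {u = u} {w = w} e p) = walk-snoc (walk-reverse p) (trans (Graph.sym G w u) e)

  DistAtMost : ℕ → Fin n → Fin n → Set
  DistAtMost d u v = ∃ λ l → l ≤ d × Walk G l u v

  distAtMost-edge : ∀ {u v} → adj G u v ≡ true → DistAtMost 1 u v
  distAtMost-edge e = 1 , ≤-refl , step e here

  distAtMost-sym : ∀ {d u v} → DistAtMost d u v → DistAtMost d v u
  distAtMost-sym (l , l≤d , p) = l , l≤d , walk-reverse p

  distAtMost-trans : ∀ {d d′ u v w} → DistAtMost d u v → DistAtMost d′ v w →
                     DistAtMost (d + d′) u w
  distAtMost-trans (l , l≤d , p) (l′ , l′≤d′ , q) = l + l′ , +-mono-≤ l≤d l′≤d′ , walk-++ p q

  distAtMost-mono : ∀ {d d′ u v} → d ≤ d′ → DistAtMost d u v → DistAtMost d′ u v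
  distAtMost-mono d≤d′ (l , l≤d , p) = l , ≤-trans l≤d d≤d′ , p

  center⇒¬Diameter≥8 : (c : Fin n) → (∀ u → DistAtMost 3 u c) → ¬ Diameter≥8 G
  center⇒¬Diameter≥8 c near (u , v , far)
    with l , l≤6 , p ← distAtMost-trans (near u) (distAtMost-sym (near v))
    = far l (s≤s (≤-trans l≤6 (s≤s (s≤s (s≤s (s≤s (s≤s (s≤s z≤n)))))))) p

EdgeInvariant : ∀ {n} {A : Set} → Graph n → (Fin n → A) → Set
EdgeInvariant G f = ∀ u v → adj G u v ≡ true → f u ≡ f v

walk-invariant : ∀ {n} {A : Set} {G : Graph n} {f : Fin n → A} → EdgeInvariant G f →
                 ∀ {l u v} → Walk G l u v → f u ≡ f v
walk-invariant inv here       = refl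
walk-invariant inv (step e p) = trans (inv _ _ e) (walk-invariant inv p)

invariant⇒DistAtLeast8 : ∀ {n} {A : Set} {G : Graph n} {f : Fin n → A} → EdgeInvariant G f →
                         ∀ {u v} → f u ≢ f v → DistAtLeast8 G u v
invariant⇒DistAtLeast8 inv fu≢fv _ _ p = fu≢fv (walk-invariant inv p)

arcGraph-invariant : ∀ {n} {R A : Set} {label : Fin n → R} {arc : R → R → Bool}
                     {arc-irrefl : ∀ r → arc r r ≡ false} {g : R → A} →
                     (∀ r r′ → arc r r′ ≡ true → g r ≡ g r′) →
                     EdgeInvariant (arcGraph label arc arc-irrefl) (g ∘ label)
arcGraph-invariant {label = label} {arc} g-inv u v e
  with ∨-≡-true {arc (label u) (label v)} e
... | inj₁ uv = g-inv _ _ uv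
... | inj₂ vu = sym (g-inv _ _ vu)

∪-invariant : ∀ {n} {A : Set} {G H : Graph n} {f : Fin n → A} →
              EdgeInvariant G f → EdgeInvariant H f → EdgeInvariant (G ∪ H) f
∪-invariant {G = G} G-inv H-inv u v e with ∨-≡-true {adj G u v} e
... | inj₁ inG = G-inv u v inG
... | inj₂ inH = H-inv u v inH

stateAfter : ∀ {n m} → Verifier n m → Certificate → List (Edge n) → Vec Bool m
stateAfter V cert = foldl (update V cert) (init V cert)

run-++ : ∀ {n m} (V : Verifier n m) cert (L L′ : List (Edge n)) →
         run V cert (L ++ L′) ≡ decide V cert (foldl (update V cert) (stateAfter V cert L) L′)
run-++ V cert L L′ = cong (decide V cert) (foldl-++ (update V cert) (init V cert) L L′)

-- The fooling-set argument of two-party communication complexity.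
module FoolingSet {n c m k : ℕ} (scheme : Scheme n c m)
  (G : Vec Bool k → Vec Bool k → Graph n) (A B : Vec Bool k → List (Edge n))
  (stream : ∀ x y → IsStream (G x y) (A x ++ B y))
  (diagonal : ∀ x → Diameter≥8 (G x x))
  (off-diagonal : ∀ {x y} → x ≢ y → ¬ Diameter≥8 (G x y))
  where

  open Scheme scheme

  certificate : Vec Bool k → Certificate
  certificate x = proj₁ (completeness (G x x) (diagonal x))

  certificate-length : ∀ x → length (certificate x) ≤ c
  certificate-length x = proj₁ (proj₂ (completeness (G x x) (diagonal x)))

  certificate-accepted : ∀ x L → IsStream (G x x) L → run verifier (certificate x) L ≡ true
  certificate-accepted x = proj₂ (proj₂ (completeness (G x x) (diagonal x)))

  fingerprint : Vec Bool k → Vec Bool (c * 2 + m)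
  fingerprint x = pad c (certificate x) ++ᵛ stateAfter verifier (certificate x) (A x)

  fingerprint-injective : ∀ {x y} → fingerprint x ≡ fingerprint y → x ≡ y
  fingerprint-injective {x} {y} eq = decidable-stable (≡-dec Bool._≟_ x y) λ x≢y →
    contradiction (trans (sym (rejected x≢y)) accepted) λ ()
    where
    open ≡-Reasoning

    same-certificate : certificate x ≡ certificate y
    same-certificate = pad-injective c (certificate-length x) (certificate-length y)
                                       (++-injectiveˡ _ _ eq)

    same-state : stateAfter verifier (certificate x) (A x) ≡ stateAfter verifier (certificate y) (A y)
    same-state = ++-injectiveʳ (pad c (certificate x)) (pad c (certificate y)) eq

    finish : Certificate → Vec Bool m → Bool
    finish w s = decide verifier w (foldl (update verifier w) s (B y))

    accepted : run verifier (certificate x) (A x ++ B y) ≡ true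
    accepted = begin
      run verifier (certificate x) (A x ++ B y)                   ≡⟨ run-++ verifier _ (A x) (B y) ⟩
      finish (certificate x) (stateAfter verifier _ (A x))        ≡⟨ cong₂ finish same-certificate same-state ⟩
      finish (certificate y) (stateAfter verifier _ (A y))        ≡⟨ run-++ verifier _ (A y) (B y) ⟨
      run verifier (certificate y) (A y ++ B y)                   ≡⟨ certificate-accepted y _ (stream y y) ⟩
      true                                                        ∎

    rejected : x ≢ y → run verifier (certificate x) (A x ++ B y) ≡ false
    rejected x≢y = soundness (G x y) (off-diagonal x≢y) (certificate x) _ (stream x y)

  k≤c*2+m : k ≤ c * 2 + m
  k≤c*2+m = Vec-↣⇒≤ (mk↣ fingerprint-injective)

data Role (k : ℕ) : Set where
  hub₀ hub₁ : Bool → Role k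
  leaf      : Fin k → Role k

role : ∀ {k} → Fin (4 + k) → Role k
role zero                      = hub₀ true
role (suc zero)                = hub₁ true
role (suc (suc zero))          = hub₀ false
role (suc (suc (suc zero)))    = hub₁ false
role (suc (suc (suc (suc j)))) = leaf j

vertex : ∀ {k} → Role k → Fin (4 + k)
vertex (hub₀ true)  = zero
vertex (hub₁ true)  = suc zero
vertex (hub₀ false) = suc (suc zero)
vertex (hub₁ false) = suc (suc (suc zero))
vertex (leaf j)     = suc (suc (suc (suc j)))

role-vertex : ∀ {k} (r : Role k) → role (vertex r) ≡ r
role-vertex (hub₀ true)  = refl
role-vertex (hub₁ true)  = refl
role-vertex (hub₀ false) = refl
role-vertex (hub₁ false) = refl
role-vertex (leaf j)     = refl

vertex-role : ∀ {k} (u : Fin (4 + k)) → vertex (role u) ≡ u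
vertex-role zero                      = refl
vertex-role (suc zero)                = refl
vertex-role (suc (suc zero))          = refl
vertex-role (suc (suc (suc zero)))    = refl
vertex-role (suc (suc (suc (suc j)))) = refl

module _ {k : ℕ} where

  alice : Vec Bool k → Role k → Role k → Bool
  alice x (hub₀ s) (hub₁ t) = ⌊ s Bool.≟ t ⌋
  alice x (hub₀ s) (leaf j) = ⌊ s Bool.≟ lookup x j ⌋
  alice x _        _        = false

  bob : Vec Bool k → Role k → Role k → Bool
  bob y (hub₁ s) (leaf j) = ⌊ s Bool.≟ lookup y j ⌋
  bob y _        _        = false

  alice-irrefl : ∀ x (r : Role k) → alice x r r ≡ false
  alice-irrefl x (hub₀ _) = refl
  alice-irrefl x (hub₁ _) = refl
  alice-irrefl x (leaf _) = refl

  bob-irrefl : ∀ y (r : Role k) → bob y r r ≡ false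
  bob-irrefl y (hub₀ _) = refl
  bob-irrefl y (hub₁ _) = refl
  bob-irrefl y (leaf _) = refl

  aliceGraph bobGraph : Vec Bool k → Graph (4 + k)
  aliceGraph x = arcGraph role (alice x) (alice-irrefl x)
  bobGraph   y = arcGraph role (bob y) (bob-irrefl y)

  graph : Vec Bool k → Vec Bool k → Graph (4 + k)
  graph x y = aliceGraph x ∪ bobGraph y

  -- Every arc of Alice has an endpoint hub₀ s, which Bob never touches.
  alice-bob-disjoint : ∀ x y (r r′ : Role k) →
                       symmetrise (alice x) r r′ ≡ true → symmetrise (bob y) r r′ ≡ false
  alice-bob-disjoint x y (hub₀ _) (hub₀ _) _  = refl
  alice-bob-disjoint x y (hub₀ _) (hub₁ _) _  = refl
  alice-bob-disjoint x y (hub₀ _) (leaf _) _  = refl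
  alice-bob-disjoint x y (hub₁ _) (hub₀ _) _  = refl
  alice-bob-disjoint x y (leaf _) (hub₀ _) _  = refl
  alice-bob-disjoint x y (hub₁ _) (hub₁ _) ()
  alice-bob-disjoint x y (hub₁ _) (leaf _) ()
  alice-bob-disjoint x y (leaf _) (hub₁ _) ()
  alice-bob-disjoint x y (leaf _) (leaf _) ()

  graph-stream : ∀ x y → IsStream (graph x y) (edges (aliceGraph x) ++ edges (bobGraph y))
  graph-stream x y = ∪-stream {G = aliceGraph x} {H = bobGraph y}
    (λ u v → alice-bob-disjoint x y (role u) (role v))
    (edges-stream (aliceGraph x)) (edges-stream (bobGraph y))

  side : Vec Bool k → Role k → Bool
  side x (hub₀ s) = s
  side x (hub₁ s) = s
  side x (leaf j) = lookup x j

  alice-side : ∀ x (r r′ : Role k) → alice x r r′ ≡ true → side x r ≡ side x r′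
  alice-side x (hub₀ _) (hub₁ _) e  = ⌊≟⌋-sound e
  alice-side x (hub₀ _) (leaf _) e  = ⌊≟⌋-sound e
  alice-side x (hub₀ _) (hub₀ _) ()
  alice-side x (hub₁ _) _        ()
  alice-side x (leaf _) _        ()

  bob-side : ∀ x (r r′ : Role k) → bob x r r′ ≡ true → side x r ≡ side x r′
  bob-side x (hub₁ _) (leaf _) e  = ⌊≟⌋-sound e
  bob-side x (hub₁ _) (hub₀ _) ()
  bob-side x (hub₁ _) (hub₁ _) ()
  bob-side x (hub₀ _) _        ()
  bob-side x (leaf _) _        ()

  graph-diagonal : ∀ x → Diameter≥8 (graph x x)
  graph-diagonal x = vertex (hub₀ true) , vertex (hub₀ false) ,
    invariant⇒DistAtLeast8 {f = side x ∘ role} side-invariant λ ()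
    where
    side-invariant : EdgeInvariant (graph x x) (side x ∘ role)
    side-invariant = ∪-invariant {G = aliceGraph x} {bobGraph x}
      (arcGraph-invariant {label = role} {arc-irrefl = alice-irrefl x} (alice-side x))
      (arcGraph-invariant {label = role} {arc-irrefl = bob-irrefl x} (bob-side x))

  -- When x i ≢ y i, leaf i is joined to hub₀ (x i) and to hub₁ (y i), one hub of each side.
  module _ {x y : Vec Bool k} {i : Fin k} (differ : lookup x i ≢ lookup y i) where

    private
      G = graph x y
      center = vertex (leaf i)

    alice-edge : ∀ r r′ → alice x r r′ ≡ true → adj G (vertex r) (vertex r′) ≡ true
    alice-edge r r′ e = ∨-≡-trueˡ _ (∨-≡-trueˡ _
      (subst₂ (λ a b → alice x a b ≡ true) (sym (role-vertex r)) (sym (role-vertex r′)) e))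

    bob-edge : ∀ r r′ → bob y r r′ ≡ true → adj G (vertex r) (vertex r′) ≡ true
    bob-edge r r′ e = ∨-≡-trueʳ (symmetrise (alice x) (role (vertex r)) (role (vertex r′)))
      (∨-≡-trueˡ _ (subst₂ (λ a b → bob y a b ≡ true) (sym (role-vertex r)) (sym (role-vertex r′)) e))

    hub-link : ∀ s → DistAtMost G 1 (vertex (hub₀ s)) (vertex (hub₁ s))
    hub-link s = distAtMost-edge G (alice-edge (hub₀ s) (hub₁ s) (⌊≟⌋-complete refl))

    hubs-near-center : ∀ s → DistAtMost G 2 (vertex (hub₀ s)) center ×
                             DistAtMost G 2 (vertex (hub₁ s)) center
    hubs-near-center s with ≢-cover differ s
    ... | inj₁ refl = distAtMost-mono G (s≤s z≤n) hub₀-center ,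
                      distAtMost-trans G (distAtMost-sym G (hub-link s)) hub₀-center
      where
      hub₀-center = distAtMost-edge G (alice-edge (hub₀ s) (leaf i) (⌊≟⌋-complete refl))
    ... | inj₂ refl = distAtMost-trans G (hub-link s) hub₁-center ,
                      distAtMost-mono G (s≤s z≤n) hub₁-center
      where
      hub₁-center = distAtMost-edge G (bob-edge (hub₁ s) (leaf i) (⌊≟⌋-complete refl))

    near-center : ∀ u → DistAtMost G 3 u center
    near-center u = subst (λ u → DistAtMost G 3 u center) (vertex-role u) (role-near (role u))
      where
      role-near : ∀ r → DistAtMost G 3 (vertex r) center
      role-near (hub₀ s) = distAtMost-mono G (s≤s (s≤s z≤n)) (proj₁ (hubs-near-center s))
      role-near (hub₁ s) = distAtMost-mono G (s≤s (s≤s z≤n)) (proj₂ (hubs-near-center s))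
      role-near (leaf j) = distAtMost-trans G
        (distAtMost-sym G (distAtMost-edge G (alice-edge (hub₀ (lookup x j)) (leaf j) (⌊≟⌋-complete refl))))
        (proj₁ (hubs-near-center (lookup x j)))

  graph-off-diagonal : ∀ {x y} → x ≢ y → ¬ Diameter≥8 (graph x y)
  graph-off-diagonal x≢y with i , differ ← lookup-≢ x≢y =
    center⇒¬Diameter≥8 _ (vertex (leaf i)) (near-center differ)

k≤c*2+m : ∀ {k c m} → Scheme (4 + k) c m → k ≤ c * 2 + m
k≤c*2+m scheme = FoolingSet.k≤c*2+m scheme graph (edges ∘ aliceGraph) (edges ∘ bobGraph)
                   graph-stream graph-diagonal graph-off-diagonal

4+k≤6*s : ∀ {k} s → 1 ≤ k → k ≤ 2 * s → 4 + k ≤ 6 * s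
4+k≤6*s     zero    1≤k k≤0  with () ← ≤-trans 1≤k k≤0
4+k≤6*s {k} (suc s) _   k≤2s =
  subst (4 + k ≤_) (sym (*-distribʳ-+ (suc s) 4 2)) (+-mono-≤ (m≤m*n 4 (suc s)) k≤2s)

c*2+m≤2*[c+m] : ∀ c m → c * 2 + m ≤ 2 * (c + m)
c*2+m≤2*[c+m] c m = subst (c * 2 + m ≤_) (sym (identity c m)) (m≤m+n (c * 2 + m) m)
  where
  identity : ∀ c m → 2 * (c + m) ≡ c * 2 + m + m
  identity = solve-∀

theorem13 : Σ ℕ λ k → Σ ℕ λ N → ∀ (n c m : ℕ) → N ≤ n → Scheme n c m → n ≤ k * (c + m)
theorem13 = 6 , 5 , λ where
  n c m (s≤s (s≤s (s≤s (s≤s 1≤k)))) scheme →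
    4+k≤6*s (c + m) 1≤k (≤-trans (k≤c*2+m scheme) (c*2+m≤2*[c+m] c m))
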